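{- For every integer $t\geq 1$, the number of tilings of the $2\times(3t+1)$ rectangle by exactly one domino and $2t$ right trominoes (counting together all possible positions of the domino) equals $(2t+1)\cdot 2^t$.
   Context: A right tromino is the L-shaped figure formed by three unit squares ($2\times 2$ square minus one unit square), in any rotation; a domino is a $1\times 2$ or $2\times 1$ rectangle of two unit squares. A tiling is a covering of the rectangle by grid-aligned copies of these pieces with disjoint interiors; tilings are counted as distinct sets of placed tiles. -}

module Defs where

open import Data.Nat using (ℕ; zero; suc; _+_; _≡ᵇ_)
open import Data.Fin using (Fin; toℕ)
open import Data.Fin.Base using (zero; suc)
open import Data.Bool using (Bool; true; false; _∧_; _∨_; not; if_then_else_)
open import Data.List using (List; map; _++_; concatMap; filter; length)
open import Data.List.Base using (allFin)
open import Data.Product using (Σ; _×_; _,_)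
open import Relation.Binary.PropositionalEquality using (_≡_)
open import Relation.Nullary.Decidable using (yes; no)
open import Data.Bool.Properties using (_≟_)

-- The board of width (suc m) is  Fin 2 × Fin (suc m)  (row, column).
-- A 2×2 block is indexed by j : Fin m and occupies columns j and j+1.

data Placement (m : ℕ) : Set where
  vdom : Fin (suc m) → Placement m
  hdom : Fin 2 → Fin m → Placement m
  -- right tromino: the 2×2 block at columns j, j+1 minus the cell
  -- (row r0, column j + c0)
  trom : Fin 2 → Fin 2 → Fin m → Placement m

_=ᶠ_ : ∀ {a b} → Fin a → Fin b → Bool
x =ᶠ y = toℕ x ≡ᵇ toℕ y

atOff0 : ∀ {m} → Fin m → Fin (suc m) → Bool
atOff0 j k = toℕ k ≡ᵇ toℕ j

atOff1 : ∀ {m} → Fin m → Fin (suc m) → Bool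
atOff1 j k = toℕ k ≡ᵇ suc (toℕ j)

offsetIs : ∀ {m} → Fin m → Fin 2 → Fin (suc m) → Bool
offsetIs j zero k = atOff0 j k
offsetIs j (suc _) k = atOff1 j k

covers : ∀ {m} → Placement m → Fin 2 → Fin (suc m) → Bool
covers (vdom c) r k = c =ᶠ k
covers (hdom r' j) r k = (r' =ᶠ r) ∧ (atOff0 j k ∨ atOff1 j k)
covers (trom r0 c0 j) r k =
  (atOff0 j k ∨ atOff1 j k) ∧ not ((r0 =ᶠ r) ∧ offsetIs j c0 k)

isDomino : ∀ {m} → Placement m → Bool
isDomino (vdom _) = true
isDomino (hdom _ _) = true
isDomino (trom _ _ _) = false

isTromino : ∀ {m} → Placement m → Bool
isTromino (trom _ _ _) = true
isTromino _ = false

allPlacements : (m : ℕ) → List (Placement m)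
allPlacements m =
  map vdom (allFin (suc m))
  ++ concatMap (λ r → map (hdom r) (allFin m)) (allFin 2)
  ++ concatMap (λ r → concatMap (λ c → map (trom r c) (allFin m)) (allFin 2)) (allFin 2)

-- A tiling of the 2 × (suc m) rectangle: a set of placed tiles (given by
-- its characteristic function) such that every cell is covered by exactly
-- one selected tile (disjoint interiors + covering).
record Tiling (m : ℕ) : Set where
  field
    sel : Placement m → Bool
    exactlyOnce : (r : Fin 2) (k : Fin (suc m)) →
      Σ (Placement m) λ p → (sel p ≡ true) × (covers p r k ≡ true) ×
        ((q : Placement m) → sel q ≡ true → covers q r k ≡ true → q ≡ p)

open Tiling public

countSel : ∀ {m} → Tiling m → (Placement m → Bool) → ℕ
countSel {m} T P = length (filter (λ p → P p ≟ true) (filter (λ p → sel T p ≟ true) (allPlacements m)))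

numDominoes : ∀ {m} → Tiling m → ℕ
numDominoes T = countSel T isDomino

numTrominoes : ∀ {m} → Tiling m → ℕ
numTrominoes T = countSel T isTromino

TilingWith : (m d e : ℕ) → Set
TilingWith m d e = Σ (Tiling m) λ T → (numDominoes T ≡ d) × (numTrominoes T ≡ e)

SameTiling : ∀ {m d e} → TilingWith m d e → TilingWith m d e → Set
SameTiling {m} (T , _) (T' , _) = (p : Placement m) → sel T p ≡ sel T' p

-- "the number of elements of A (up to ≈) is N": an explicit bijection
-- Fin N ↔ A, where A is compared by ≈.
HasCount : (A : Set) → (A → A → Set) → ℕ → Set
HasCount A _≈_ N =
  Σ (Fin N → A) λ f → Σ (A → Fin N) λ g →
    ((i : Fin N) → g (f i) ≡ i) × ((a : A) → f (g a) ≈ a) ×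
    ((a b : A) → a ≈ b → g a ≡ g b)

module Submission where

-- Read a tiling column by column.  The tiles meeting the first column are constrained only by
-- which cells of that column are already occupied by a tile reaching in from the left (its
-- profile), so tilings of a 2 × n board correspond to walks of length n from the empty profile
-- back to it in a transfer graph on the four profiles, each of the nine steps placing a fixed
-- set of tiles.  A domino-free walk splits into 2 × 3 rectangles, each tiled by two trominoes in
-- one of two ways, giving 2^t.  A walk with one domino starts with the vertical domino followed
-- by a domino-free walk, or with a 2 × 3 rectangle followed by a one-domino walk, or with a
-- 2 × 4 rectangle of two trominoes around a horizontal domino followed by a domino-free walk,
-- the last two in two mirror-image ways.  So the number W(t) of one-domino walks of length
-- 3t + 1 satisfies W(t+1) = 2^(t+1) + 2 (2^t + W(t)), whence W(t) = (2t + 1) 2^t.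

open import Defs
open import Algebra.Properties.CommutativeSemigroup using (interchange)
open import Data.Bool using (Bool; true; false; _∧_; not)
open import Data.Bool.Properties using (∧-zeroʳ) renaming (_≟_ to _≟ᵇ_)
open import Data.Empty using (⊥; ⊥-elim)
open import Data.Fin using (Fin; zero; suc; _↑ˡ_)
open import Data.Fin.Patterns using (0F; 1F)
open import Data.Fin.Properties using (_≟_; +↔⊎)
open import Data.List using (List; []; _∷_; _++_; map; concat; filter; length; zipWith; tabulate; allFin)
open import Data.List.Membership.Propositional using (_∈_)
open import Data.List.Properties using (map-tabulate; map-∘; map-cong; concat-concat; concat-++)
open import Data.List.Relation.Unary.All as All using (All; []; _∷_)
open import Data.List.Relation.Unary.Any using (here; there)
open import Data.Nat using (ℕ; zero; suc; _+_; _*_; _^_; _≤_)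
open import Data.Nat.ListAction using (sum)
open import Data.Nat.Properties
  using (*-suc; ≡-irrelevant; suc-injective; +-assoc; +-identityʳ; +-commutativeSemigroup)
open import Data.Nat.Tactic.RingSolver using (solve-∀)
open import Data.Product using (Σ; _×_; _,_; proj₁; proj₂)
open import Data.Sum using (_⊎_; inj₁; inj₂)
open import Data.Sum.Function.Propositional using (_⊎-↔_)
open import Function using (_∘_; id)
open import Function.Bundles using (Inverse; _↔_; mk↔ₛ′)
open import Function.Properties.Inverse using (↔-trans)
open import Function.Related.Propositional using (module EquationalReasoning)
open import Relation.Binary.Definitions using (DecidableEquality)
open import Relation.Binary.PropositionalEquality
open import Relation.Nullary using (yes; no; does; map′)
open import Relation.Nullary.Decidable using (_×-dec_)

true≢false : true ≢ false
true≢false ()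

∧-true⁻ : ∀ {a b} → a ∧ b ≡ true → (a ≡ true) × (b ≡ true)
∧-true⁻ {true} {true} refl = refl , refl

∧-true⁺ : ∀ {a b} → a ≡ true → b ≡ true → a ∧ b ≡ true
∧-true⁺ refl refl = refl

bit : Bool → ℕ
bit true  = 1
bit false = 0

bit-injective : ∀ {a b} → bit a ≡ bit b → a ≡ b
bit-injective {true}  {true}  _ = refl
bit-injective {false} {false} _ = refl

count : ∀ {A : Set} → (A → Bool) → List A → ℕ
count p []       = 0
count p (x ∷ xs) = bit (p x) + count p xs

module _ {A : Set} where

  count-cong : {p q : A → Bool} → p ≗ q → ∀ xs → count p xs ≡ count q xs
  count-cong p≗q []       = refl
  count-cong p≗q (x ∷ xs) = cong₂ _+_ (cong bit (p≗q x)) (count-cong p≗q xs)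

  count≡0⇒false : ∀ (p : A → Bool) xs → count p xs ≡ 0 → ∀ {x} → x ∈ xs → p x ≡ false
  count≡0⇒false p (y ∷ ys) c x∈ with p y in py
  count≡0⇒false p (y ∷ ys) () x∈          | true
  count≡0⇒false p (y ∷ ys) c  (here refl) | false = py
  count≡0⇒false p (y ∷ ys) c  (there x∈)  | false = count≡0⇒false p ys c x∈

  count≡1⇒witness : ∀ (p : A → Bool) xs → count p xs ≡ 1 → Σ A λ x → x ∈ xs × p x ≡ true
  count≡1⇒witness p (y ∷ ys) c with p y in py
  ... | true  = y , here refl , py
  ... | false = let x , x∈ , px = count≡1⇒witness p ys c in x , there x∈ , px

  count≡1⇒unique : ∀ (p : A → Bool) xs → count p xs ≡ 1 → ∀ {x y} → x ∈ xs → y ∈ xs →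
                   p x ≡ true → p y ≡ true → x ≡ y
  count≡1⇒unique p (z ∷ zs) c x∈ y∈ px py with p z in pz
  count≡1⇒unique p (z ∷ zs) c (here refl) (here refl) px py | true = refl
  count≡1⇒unique p (z ∷ zs) c (here refl) (there y∈)  px py | true =
    ⊥-elim (true≢false (trans (sym py) (count≡0⇒false p zs (suc-injective c) y∈)))
  count≡1⇒unique p (z ∷ zs) c (there x∈)  y∈          px py | true =
    ⊥-elim (true≢false (trans (sym px) (count≡0⇒false p zs (suc-injective c) x∈)))
  count≡1⇒unique p (z ∷ zs) c (here refl) y∈          px py | false = ⊥-elim (true≢false (trans (sym px) pz))
  count≡1⇒unique p (z ∷ zs) c (there x∈)  (here refl) px py | false = ⊥-elim (true≢false (trans (sym py) pz))
  count≡1⇒unique p (z ∷ zs) c (there x∈)  (there y∈)  px py | false = count≡1⇒unique p zs c x∈ y∈ px py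

module _ {A : Set} (q : A → Bool) where

  count-++ : ∀ xs ys → count q (xs ++ ys) ≡ count q xs + count q ys
  count-++ []       ys = refl
  count-++ (x ∷ xs) ys = trans (cong (bit (q x) +_) (count-++ xs ys)) (sym (+-assoc (bit (q x)) _ _))

  count-concat : ∀ xss → count q (concat xss) ≡ sum (map (count q) xss)
  count-concat []         = refl
  count-concat (xs ∷ xss) = trans (count-++ xs (concat xss)) (cong (count q xs +_) (count-concat xss))

  count-filter : ∀ (p : A → Bool) xs →
                 length (filter (λ x → q x ≟ᵇ true) (filter (λ x → p x ≟ᵇ true) xs)) ≡
                 count (λ x → p x ∧ q x) xs
  count-filter p []       = refl
  count-filter p (x ∷ xs) with p x
  ... | false = count-filter p xs
  ... | true with q x
  ...   | true  = cong suc (count-filter p xs)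
  ...   | false = count-filter p xs

countFin : ∀ n → (Fin n → Bool) → ℕ
countFin zero    p = 0
countFin (suc n) p = bit (p zero) + countFin n (p ∘ suc)

count-allFin : ∀ {A : Set} (q : A → Bool) n (f : Fin n → A) → count q (map f (allFin n)) ≡ countFin n (q ∘ f)
count-allFin q n f = trans (cong (count q) (map-tabulate id f)) (count-tabulate n f)
  where
  count-tabulate : ∀ n (f : Fin n → _) → count q (tabulate f) ≡ countFin n (q ∘ f)
  count-tabulate zero    f = refl
  count-tabulate (suc n) f = cong (bit (q (f zero)) +_) (count-tabulate n (f ∘ suc))

sum-zipWith-+ : ∀ xs ys → length xs ≡ length ys → sum (zipWith _+_ xs ys) ≡ sum xs + sum ys
sum-zipWith-+ []       []       _ = refl
sum-zipWith-+ (x ∷ xs) (y ∷ ys) l =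
  trans (cong ((x + y) +_) (sum-zipWith-+ xs ys (suc-injective l)))
        (interchange +-commutativeSemigroup x y (sum xs) (sum ys))

-- Splitting a board into its first column and the rest

data Head : Set where
  vert   : Head
  horiz  : Fin 2 → Head
  corner : Fin 2 → Fin 2 → Head

head : ∀ {m} → Head → Placement (suc m)
head vert         = vdom zero
head (horiz r)    = hdom r zero
head (corner r c) = trom r c zero

shift : ∀ {m} → Placement m → Placement (suc m)
shift (vdom k)     = vdom (suc k)
shift (hdom r j)   = hdom r (suc j)
shift (trom r c j) = trom r c (suc j)

data Split {m} : Placement (suc m) → Set where
  headOf  : (h : Head) → Split (head h)
  shifted : (q : Placement m) → Split (shift q)

split : ∀ {m} (p : Placement (suc m)) → Split p
split (vdom zero)        = headOf vert
split (vdom (suc k))     = shifted (vdom k)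
split (hdom r zero)      = headOf (horiz r)
split (hdom r (suc j))   = shifted (hdom r j)
split (trom r c zero)    = headOf (corner r c)
split (trom r c (suc j)) = shifted (trom r c j)

head-injective : ∀ {m} {h h'} → head {m} h ≡ head h' → h ≡ h'
head-injective {h = vert}       {vert}       refl = refl
head-injective {h = horiz _}    {horiz _}    refl = refl
head-injective {h = corner _ _} {corner _ _} refl = refl

shift-injective : ∀ {m} {p q : Placement m} → shift p ≡ shift q → p ≡ q
shift-injective {p = vdom _}     {vdom _}     refl = refl
shift-injective {p = hdom _ _}   {hdom _ _}   refl = refl
shift-injective {p = trom _ _ _} {trom _ _ _} refl = refl

shift≢head : ∀ {m} (q : Placement m) h → shift q ≢ head h
shift≢head (vdom _)     vert         ()
shift≢head (hdom _ _)   (horiz _)    ()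
shift≢head (trom _ _ _) (corner _ _) ()

_≟ʰ_ : DecidableEquality Head
vert       ≟ʰ vert         = yes refl
horiz r    ≟ʰ horiz r'     = map′ (cong horiz) (λ { refl → refl }) (r ≟ r')
corner r c ≟ʰ corner r' c' =
  map′ (λ (p , q) → cong₂ corner p q) (λ { refl → refl , refl }) ((r ≟ r') ×-dec (c ≟ c'))
vert       ≟ʰ horiz _      = no λ ()
vert       ≟ʰ corner _ _   = no λ ()
horiz _    ≟ʰ vert         = no λ ()
horiz _    ≟ʰ corner _ _   = no λ ()
corner _ _ ≟ʰ vert         = no λ ()
corner _ _ ≟ʰ horiz _      = no λ ()

open import Data.List.Membership.DecPropositional _≟ʰ_ using (_∈?_)

allHeads : List Head
allHeads = vert ∷ horiz 0F ∷ horiz 1F ∷ corner 0F 0F ∷ corner 0F 1F ∷ corner 1F 0F ∷ corner 1F 1F ∷ []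

∈-allHeads : ∀ h → h ∈ allHeads
∈-allHeads vert           = here refl
∈-allHeads (horiz 0F)     = there (here refl)
∈-allHeads (horiz 1F)     = there (there (here refl))
∈-allHeads (corner 0F 0F) = there (there (there (here refl)))
∈-allHeads (corner 0F 1F) = there (there (there (there (here refl))))
∈-allHeads (corner 1F 0F) = there (there (there (there (there (here refl)))))
∈-allHeads (corner 1F 1F) = there (there (there (there (there (there (here refl))))))

countHeads : (Head → Bool) → ℕ
countHeads H = count H allHeads

headCovers : Head → Fin 2 → Fin 2 → Bool
headCovers h = covers (head {0} h)

hits : (Head → Bool) → Fin 2 → Fin 2 → Head → Bool
hits H r c h = H h ∧ headCovers h r c

covers-head : ∀ {m} h r c → covers (head {m} h) r (c ↑ˡ m) ≡ headCovers h r c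
covers-head vert          r 0F = refl
covers-head vert          r 1F = refl
covers-head (horiz _)     r 0F = refl
covers-head (horiz _)     r 1F = refl
covers-head (corner _ 0F) r 0F = refl
covers-head (corner _ 0F) r 1F = refl
covers-head (corner _ 1F) r 0F = refl
covers-head (corner _ 1F) r 1F = refl

hit⁺ : ∀ {m} H h r c → H h ≡ true → covers (head {m} h) r (c ↑ˡ m) ≡ true → hits H r c h ≡ true
hit⁺ H h r c Hh ch = ∧-true⁺ Hh (trans (sym (covers-head h r c)) ch)

hit⁻ : ∀ {m} H h r c → hits H r c h ≡ true → (H h ≡ true) × (covers (head {m} h) r (c ↑ˡ m) ≡ true)
hit⁻ H h r c hit = let Hh , ch = ∧-true⁻ hit in Hh , trans (covers-head h r c) ch

covers-shift : ∀ {m} (q : Placement m) r k → covers (shift q) r (suc k) ≡ covers q r k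
covers-shift (vdom _)      r k = refl
covers-shift (hdom _ _)    r k = refl
covers-shift (trom _ 0F _) r k = refl
covers-shift (trom _ 1F _) r k = refl

shift-misses-column₀ : ∀ {m} (q : Placement m) r → covers (shift q) r zero ≢ true
shift-misses-column₀ (vdom _)      r ()
shift-misses-column₀ (hdom r' _)   r c = true≢false (trans (sym c) (∧-zeroʳ (r' =ᶠ r)))
shift-misses-column₀ (trom _ 0F _) r ()
shift-misses-column₀ (trom _ 1F _) r ()

head-misses-beyond : ∀ {m} h r (k : Fin m) → covers (head {m} h) r (suc (suc k)) ≢ true
head-misses-beyond vert          r k ()
head-misses-beyond (horiz r')    r k c = true≢false (trans (sym c) (∧-zeroʳ (r' =ᶠ r)))
head-misses-beyond (corner _ 0F) r k ()
head-misses-beyond (corner _ 1F) r k ()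

head-meets-column₀ : ∀ h → Σ (Fin 2) λ r → headCovers h r 0F ≡ true
head-meets-column₀ vert           = 0F , refl
head-meets-column₀ (horiz 0F)     = 0F , refl
head-meets-column₀ (horiz 1F)     = 1F , refl
head-meets-column₀ (corner 0F 0F) = 1F , refl
head-meets-column₀ (corner 0F 1F) = 0F , refl
head-meets-column₀ (corner 1F 0F) = 0F , refl
head-meets-column₀ (corner 1F 1F) = 0F , refl

glue : ∀ {m} → (Head → Bool) → (Placement m → Bool) → Placement (suc m) → Bool
glue H s (vdom zero)        = H vert
glue H s (vdom (suc k))     = s (vdom k)
glue H s (hdom r zero)      = H (horiz r)
glue H s (hdom r (suc j))   = s (hdom r j)
glue H s (trom r c zero)    = H (corner r c)
glue H s (trom r c (suc j)) = s (trom r c j)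

glue-head : ∀ {m} H (s : Placement m → Bool) h → glue H s (head h) ≡ H h
glue-head H s vert         = refl
glue-head H s (horiz r)    = refl
glue-head H s (corner r c) = refl

glue-shift : ∀ {m} H (s : Placement m → Bool) q → glue H s (shift q) ≡ s q
glue-shift H s (vdom k)     = refl
glue-shift H s (hdom r j)   = refl
glue-shift H s (trom r c j) = refl

glue-split : ∀ {m} (s : Placement (suc m) → Bool) → glue (s ∘ head) (s ∘ shift) ≗ s
glue-split s p with split p
... | headOf h  = glue-head _ _ h
... | shifted q = glue-shift _ _ q

glue-cong : ∀ {m} {H H' : Head → Bool} {s s' : Placement m → Bool} →
            H ≗ H' → s ≗ s' → glue H s ≗ glue H' s'
glue-cong {H = H} {H'} {s} {s'} H≗H' s≗s' p with split p
... | headOf h  = trans (glue-head H s h) (trans (H≗H' h) (sym (glue-head H' s' h)))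
... | shifted q = trans (glue-shift H s q) (trans (s≗s' q) (sym (glue-shift H' s' q)))

glue-injective : ∀ {m} {H H' : Head → Bool} {s s' : Placement m → Bool} →
                 glue H s ≗ glue H' s' → H ≗ H' × s ≗ s'
glue-injective {H = H} {H'} {s} {s'} eq =
  (λ h → trans (sym (glue-head H s h)) (trans (eq (head h)) (glue-head H' s' h))) ,
  (λ q → trans (sym (glue-shift H s q)) (trans (eq (shift q)) (glue-shift H' s' q)))

-- Tilings of a board whose first column is partly filled in advance

-- Cells of the first column already occupied from the left: row 0, then row 1.
data Profile : Set where
  FF FT TF TT : Profile

filled : Profile → Fin 2 → Bool
filled FF _  = false
filled FT 0F = false
filled FT 1F = true
filled TF 0F = true
filled TF 1F = false
filled TT _  = true

fromRows : Bool → Bool → Profile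
fromRows false false = FF
fromRows false true  = FT
fromRows true  false = TF
fromRows true  true  = TT

fromRows-filled : ∀ S → fromRows (filled S 0F) (filled S 1F) ≡ S
fromRows-filled FF = refl
fromRows-filled FT = refl
fromRows-filled TF = refl
fromRows-filled TT = refl

module _ {m : ℕ} (s : Placement m → Bool) (r : Fin 2) (k : Fin (suc m)) where

  CoveredOnce : Set
  CoveredOnce = Σ (Placement m) λ p → (s p ≡ true) × (covers p r k ≡ true) ×
                  ((q : Placement m) → s q ≡ true → covers q r k ≡ true → q ≡ p)

  Uncovered : Set
  Uncovered = (q : Placement m) → s q ≡ true → covers q r k ≡ true → ⊥

Cell : ∀ {m} → Bool → (Placement m → Bool) → Fin 2 → Fin (suc m) → Set
Cell true  = Uncovered
Cell false = CoveredOnce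

preFilled : ∀ {m} → Profile → Fin 2 → Fin (suc m) → Bool
preFilled S r zero    = filled S r
preFilled S r (suc _) = false

Tiles : (m : ℕ) → Profile → (Placement m → Bool) → Set
Tiles m S s = ∀ r k → Cell (preFilled S r k) s r k

tiling⇒tiles : ∀ {m} (T : Tiling m) → Tiles m FF (sel T)
tiling⇒tiles T r zero    = exactlyOnce T r zero
tiling⇒tiles T r (suc k) = exactlyOnce T r (suc k)

tiles⇒tiling : ∀ {m} {s : Placement m → Bool} → Tiles m FF s → Tiling m
tiles⇒tiling {s = s} v = record
  { sel = s ; exactlyOnce = λ { r zero → v r zero ; r (suc k) → v r (suc k) } }

module _ {m S} {s : Placement m → Bool} (v : Tiles m S s) where

  tiles-disjoint : ∀ {p q r k} → s p ≡ true → s q ≡ true →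
                   covers p r k ≡ true → covers q r k ≡ true → p ≡ q
  tiles-disjoint {p} {q} {r} {k} sp sq cp cq with preFilled S r k | v r k
  ... | true  | uncovered         = ⊥-elim (uncovered p sp cp)
  ... | false | (_ , _ , _ , one) = trans (one p sp cp) (sym (one q sq cq))

  tiles-avoid-filled : ∀ {r p} → filled S r ≡ true → s p ≡ true → covers p r zero ≡ true → ⊥
  tiles-avoid-filled {r} {p} f sp cp with filled S r | v r zero
  ... | true  | uncovered = uncovered p sp cp
  ... | false | _         = true≢false (sym f)

record Fits (S : Profile) (H : Head → Bool) (S' : Profile) : Set where
  field
    completes : ∀ r → countHeads (hits H r 0F) ≡ bit (not (filled S r))
    leaves    : ∀ r → countHeads (hits H r 1F) ≡ bit (filled S' r)

fits-cong : ∀ {S H H' S'} → H ≗ H' → Fits S H S' → Fits S H' S'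
fits-cong {H = H} {H'} H≗H' f = record
  { completes = λ r → trans (sym (hits-cong r 0F)) (Fits.completes f r)
  ; leaves    = λ r → trans (sym (hits-cong r 1F)) (Fits.leaves f r)
  }
  where
  hits-cong : ∀ r c → countHeads (hits H r c) ≡ countHeads (hits H' r c)
  hits-cong r c = count-cong (λ h → cong (_∧ headCovers h r c) (H≗H' h)) allHeads

fits-next-unique : ∀ {S H S₁ S₂} → Fits S H S₁ → Fits S H S₂ → S₁ ≡ S₂
fits-next-unique {S₁ = S₁} {S₂} f₁ f₂ = begin
  S₁                                     ≡⟨ fromRows-filled S₁ ⟨
  fromRows (filled S₁ 0F) (filled S₁ 1F) ≡⟨ cong₂ fromRows (same 0F) (same 1F) ⟩
  fromRows (filled S₂ 0F) (filled S₂ 1F) ≡⟨ fromRows-filled S₂ ⟩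
  S₂                                     ∎
  where
  open ≡-Reasoning
  same : ∀ r → filled S₁ r ≡ filled S₂ r
  same r = bit-injective (trans (sym (Fits.leaves f₁ r)) (Fits.leaves f₂ r))

HeadFree : ∀ {m} → (Head → Bool) → Fin 2 → Fin (suc (suc m)) → Set
HeadFree {m} H r k = ∀ h → H h ≡ true → covers (head {m} h) r k ≡ true → ⊥

module _ {m : ℕ} (H : Head → Bool) {r : Fin 2} where

  count≡0⇒headFree : ∀ c → countHeads (hits H r c) ≡ 0 → HeadFree {m} H r (c ↑ˡ m)
  count≡0⇒headFree c none h Hh ch =
    true≢false (trans (sym (hit⁺ H h r c Hh ch)) (count≡0⇒false (hits H r c) allHeads none (∈-allHeads h)))

  headFree-beyond : ∀ {k} → HeadFree {m} H r (suc (suc k))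
  headFree-beyond {k} h _ = head-misses-beyond h r k

module _ {m : ℕ} (H : Head → Bool) (s : Placement m → Bool) {r : Fin 2} where

  coveredOnce-byHead : ∀ c → countHeads (hits H r c) ≡ 1 →
                       (∀ q → s q ≡ true → covers (shift q) r (c ↑ˡ m) ≡ true → ⊥) →
                       CoveredOnce (glue H s) r (c ↑ˡ m)
  coveredOnce-byHead c one tail-misses with h , _ , hit ← count≡1⇒witness (hits H r c) allHeads one =
    head h , trans (glue-head H s h) (proj₁ (hit⁻ {m} H h r c hit)) , proj₂ (hit⁻ H h r c hit) , unique
    where
    unique : ∀ q → glue H s q ≡ true → covers q r (c ↑ˡ m) ≡ true → q ≡ head h
    unique q gq cq with split q
    ... | headOf h'  = cong head (count≡1⇒unique (hits H r c) allHeads one (∈-allHeads h') (∈-allHeads h)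
                                                (hit⁺ H h' r c (trans (sym (glue-head H s h')) gq) cq) hit)
    ... | shifted q' = ⊥-elim (tail-misses q' (trans (sym (glue-shift H s q')) gq) cq)

  coveredOnce-byTail : ∀ {k} → HeadFree H r (suc k) → CoveredOnce s r k → CoveredOnce (glue H s) r (suc k)
  coveredOnce-byTail {k} free (w , sw , cw , one) =
    shift w , trans (glue-shift H s w) sw , trans (covers-shift w r k) cw , unique
    where
    unique : ∀ q → glue H s q ≡ true → covers q r (suc k) ≡ true → q ≡ shift w
    unique q gq cq with split q
    ... | headOf h   = ⊥-elim (free h (trans (sym (glue-head H s h)) gq) cq)
    ... | shifted q' = cong shift (one q' (trans (sym (glue-shift H s q')) gq)
                                          (trans (sym (covers-shift q' r k)) cq))

  uncovered-column₀ : countHeads (hits H r 0F) ≡ 0 → Uncovered (glue H s) r zero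
  uncovered-column₀ none q gq cq with split q
  ... | headOf h   = count≡0⇒headFree H 0F none h (trans (sym (glue-head H s h)) gq) cq
  ... | shifted q' = shift-misses-column₀ q' r cq

coveredOnce-unshift : ∀ {m} {s : Placement (suc m) → Bool} {r k} →
                      HeadFree (s ∘ head) r (suc k) → CoveredOnce s r (suc k) → CoveredOnce (s ∘ shift) r k
coveredOnce-unshift {s = s} {r} {k} free (w , sw , cw , one) with split w
... | headOf h  = ⊥-elim (free h sw cw)
... | shifted q = q , sw , trans (sym (covers-shift q r k)) cw ,
                  λ q' sq' cq' → shift-injective (one (shift q') sq' (trans (covers-shift q' r k) cq'))

glue-tiles : ∀ {m S S' H} {s : Placement m → Bool} → Fits S H S' → Tiles m S' s → Tiles (suc m) S (glue H s)
glue-tiles {S = S} {H = H} {s} fits v r zero with filled S r | Fits.completes fits r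
... | true  | none = uncovered-column₀ H s none
... | false | one  = coveredOnce-byHead H s 0F one λ q _ → shift-misses-column₀ q r
glue-tiles {S' = S'} {H = H} {s} fits v r (suc zero) with filled S' r | Fits.leaves fits r | v r zero
... | true  | one  | uncovered =
  coveredOnce-byHead H s 1F one λ q sq cq → uncovered q sq (trans (sym (covers-shift q r zero)) cq)
... | false | none | once = coveredOnce-byTail H s (count≡0⇒headFree H 1F none) once
glue-tiles {H = H} {s} fits v r (suc (suc k)) = coveredOnce-byTail H s (headFree-beyond H) (v r (suc k))

tail-tiles : ∀ {m S S'} {s : Placement (suc m) → Bool} → Tiles (suc m) S s →
             (∀ r → countHeads (hits (s ∘ head) r 1F) ≡ bit (filled S' r)) → Tiles m S' (s ∘ shift)
tail-tiles {S' = S'} {s} v leaves r zero with filled S' r | leaves r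
... | true  | one  = λ q sq cq →
  let h , _ , hit = count≡1⇒witness (hits (s ∘ head) r 1F) allHeads one
      sh , ch = hit⁻ (s ∘ head) h r 1F hit
  in shift≢head q h (tiles-disjoint v sq sh (trans (covers-shift q r zero) cq) ch)
... | false | none = coveredOnce-unshift (count≡0⇒headFree (s ∘ head) 1F none) (v r (suc zero))
tail-tiles {s = s} v leaves r (suc k) = coveredOnce-unshift (headFree-beyond (s ∘ head)) (v r (suc (suc k)))

-- The transfer graph

-- putTᵣ꜀ places the tromino of the first 2 × 2 block that misses its cell (row r, column c).
data Step : Profile → Profile → Set where
  putV   : Step FF FF
  putH²  : Step FF TT
  putT₀₁ : Step FF FT
  putT₁₁ : Step FF TF
  putH₀  : Step FT TF
  putT₁₀ : Step FT TT
  putH₁  : Step TF FT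
  putT₀₀ : Step TF TT
  pass   : Step TT FF

tiles : ∀ {S S'} → Step S S' → List Head
tiles putV   = vert ∷ []
tiles putH²  = horiz 0F ∷ horiz 1F ∷ []
tiles putT₀₁ = corner 0F 1F ∷ []
tiles putT₁₁ = corner 1F 1F ∷ []
tiles putH₀  = horiz 0F ∷ []
tiles putT₁₀ = corner 1F 0F ∷ []
tiles putH₁  = horiz 1F ∷ []
tiles putT₀₀ = corner 0F 0F ∷ []
tiles pass   = []

placed : ∀ {S S'} → Step S S' → Head → Bool
placed σ h = does (h ∈? tiles σ)

placed⇒∈ : ∀ {S S'} (σ : Step S S') {h} → placed σ h ≡ true → h ∈ tiles σ
placed⇒∈ σ {h} p with h ∈? tiles σ
... | yes h∈ = h∈

step-irrelevant : ∀ {S S'} (σ τ : Step S S') → σ ≡ τ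
step-irrelevant putV   putV   = refl
step-irrelevant putH²  putH²  = refl
step-irrelevant putT₀₁ putT₀₁ = refl
step-irrelevant putT₁₁ putT₁₁ = refl
step-irrelevant putH₀  putH₀  = refl
step-irrelevant putT₁₀ putT₁₀ = refl
step-irrelevant putH₁  putH₁  = refl
step-irrelevant putT₀₀ putT₀₀ = refl
step-irrelevant pass   pass   = refl

byRows : ∀ {P : Fin 2 → Set} → P 0F → P 1F → ∀ r → P r
byRows p₀ p₁ 0F = p₀
byRows p₀ p₁ 1F = p₁

fits : ∀ {S S'} (σ : Step S S') → Fits S (placed σ) S'
fits putV   = record { completes = byRows refl refl ; leaves = byRows refl refl }
fits putH²  = record { completes = byRows refl refl ; leaves = byRows refl refl }
fits putT₀₁ = record { completes = byRows refl refl ; leaves = byRows refl refl }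
fits putT₁₁ = record { completes = byRows refl refl ; leaves = byRows refl refl }
fits putH₀  = record { completes = byRows refl refl ; leaves = byRows refl refl }
fits putT₁₀ = record { completes = byRows refl refl ; leaves = byRows refl refl }
fits putH₁  = record { completes = byRows refl refl ; leaves = byRows refl refl }
fits putT₀₀ = record { completes = byRows refl refl ; leaves = byRows refl refl }
fits pass   = record { completes = byRows refl refl ; leaves = byRows refl refl }

data Walk : Profile → ℕ → Set where
  []  : Walk FF 0
  _∷_ : ∀ {S S' n} → Step S S' → Walk S' n → Walk S (suc n)

enc : ∀ {S m} → Walk S (suc m) → Placement m → Bool
enc {m = zero}  (σ ∷ []) (vdom zero) = placed σ vert
enc {m = suc m} (σ ∷ w)              = glue (placed σ) (enc w)

enc-tiles : ∀ {S m} (w : Walk S (suc m)) → Tiles m S (enc w)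
enc-tiles {m = zero}  (putV ∷ []) r zero = vdom zero , refl , refl , λ { (vdom zero) _ _ → refl }
enc-tiles {m = zero}  (pass ∷ []) r zero = λ { (vdom zero) () _ }
enc-tiles {m = suc m} (σ ∷ w)            = glue-tiles (fits σ) (enc-tiles w)

enc-injective : ∀ {S m} (w w' : Walk S (suc m)) → enc w ≗ enc w' → w ≡ w'
enc-injective {m = zero}  (σ ∷ []) (τ ∷ []) _ = cong (_∷ []) (step-irrelevant σ τ)
enc-injective {m = suc m} (σ ∷ w)  (τ ∷ w') eq
  with heads , tails ← glue-injective eq
  with refl ← fits-next-unique (fits σ) (fits-cong (sym ∘ heads) (fits τ))
  with refl ← step-irrelevant σ τ
  = cong (σ ∷_) (enc-injective w w' tails)

module _ {m S} {s : Placement (suc m) → Bool} (v : Tiles (suc m) S s) where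

  heads-disjoint : ∀ {h h'} → s (head h) ≡ true → s (head h') ≡ true →
                   ∀ r c → headCovers h r c ≡ true → headCovers h' r c ≡ true → h ≡ h'
  heads-disjoint {h} {h'} sh sh' r c ch ch' =
    head-injective (tiles-disjoint v sh sh' (trans (covers-head h r c) ch) (trans (covers-head h' r c) ch'))

  covering-head : ∀ r → filled S r ≡ false → Σ Head λ h → (s (head h) ≡ true) × (headCovers h r 0F ≡ true)
  covering-head r f with filled S r | v r zero
  ... | false | (w , sw , cw , _) with split w
  ...   | headOf h  = h , sw , trans (sym (covers-head h r 0F)) cw
  ...   | shifted q = ⊥-elim (shift-misses-column₀ q r cw)

  -- A selected head outside σ meets some cell of the first column, which is either filled in
  -- advance or covered by a tile of σ.
  determined : ∀ {S'} (σ : Step S S') → All (λ h → s (head h) ≡ true) (tiles σ) → s ∘ head ≗ placed σ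
  determined σ selected h with placed σ h in p
  ... | true  = All.lookup selected (placed⇒∈ σ p)
  ... | false with s (head h) in sh
  ...   | false = refl
  ...   | true with r , hr ← head-meets-column₀ h | filled S r in f
  ...     | true  = ⊥-elim (tiles-avoid-filled v f sh (trans (covers-head h r 0F) hr))
  ...     | false
    with h' , _ , hit ← count≡1⇒witness (hits (placed σ) r 0F) allHeads
                          (trans (Fits.completes (fits σ) r) (cong (bit ∘ not) f))
    with p' , h'r ← ∧-true⁻ hit
    with refl ← heads-disjoint sh (All.lookup selected (placed⇒∈ σ p')) r 0F hr h'r
    = ⊥-elim (true≢false (trans (sym p') p))

  below-horiz₀ : filled S 1F ≡ false → s (head (horiz 0F)) ≡ true → s (head (horiz 1F)) ≡ true
  below-horiz₀ free sv with covering-head 1F free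
  ... | horiz 1F     , sv' , _ = sv'
  ... | horiz 0F     , _   , ()
  ... | corner 1F 0F , _   , ()
  ... | vert         , sv' , _ with () ← heads-disjoint sv sv' 0F 0F refl refl
  ... | corner 0F 0F , sv' , _ with () ← heads-disjoint sv sv' 0F 1F refl refl
  ... | corner 0F 1F , sv' , _ with () ← heads-disjoint sv sv' 0F 0F refl refl
  ... | corner 1F 1F , sv' , _ with () ← heads-disjoint sv sv' 0F 0F refl refl

  no-corner₁₀ : filled S 1F ≡ false → s (head (corner 1F 0F)) ≢ true
  no-corner₁₀ free sv with covering-head 1F free
  ... | horiz 0F     , _   , ()
  ... | corner 1F 0F , _   , ()
  ... | vert         , sv' , _ with () ← heads-disjoint sv sv' 0F 0F refl refl
  ... | horiz 1F     , sv' , _ with () ← heads-disjoint sv sv' 1F 1F refl refl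
  ... | corner 0F 0F , sv' , _ with () ← heads-disjoint sv sv' 0F 1F refl refl
  ... | corner 0F 1F , sv' , _ with () ← heads-disjoint sv sv' 0F 0F refl refl
  ... | corner 1F 1F , sv' , _ with () ← heads-disjoint sv sv' 0F 0F refl refl

first-step : ∀ {m S} {s : Placement (suc m) → Bool} → Tiles (suc m) S s →
             Σ Profile λ S' → Σ (Step S S') λ σ → s ∘ head ≗ placed σ
first-step {S = FF} v with covering-head v 0F refl
... | vert         , sv , _ = _ , putV   , determined v putV   (sv ∷ [])
... | horiz 0F     , sv , _ = _ , putH²  , determined v putH²  (sv ∷ below-horiz₀ v refl sv ∷ [])
... | corner 0F 1F , sv , _ = _ , putT₀₁ , determined v putT₀₁ (sv ∷ [])
... | corner 1F 1F , sv , _ = _ , putT₁₁ , determined v putT₁₁ (sv ∷ [])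
... | corner 1F 0F , sv , _ = ⊥-elim (no-corner₁₀ v refl sv)
... | horiz 1F     , _  , ()
... | corner 0F 0F , _  , ()
first-step {S = FT} v with covering-head v 0F refl
... | horiz 0F     , sv , _ = _ , putH₀  , determined v putH₀  (sv ∷ [])
... | corner 1F 0F , sv , _ = _ , putT₁₀ , determined v putT₁₀ (sv ∷ [])
... | horiz 1F     , _  , ()
... | corner 0F 0F , _  , ()
... | vert         , sv , _ = ⊥-elim (tiles-avoid-filled v {1F} refl sv refl)
... | corner 0F 1F , sv , _ = ⊥-elim (tiles-avoid-filled v {1F} refl sv refl)
... | corner 1F 1F , sv , _ = ⊥-elim (tiles-avoid-filled v {1F} refl sv refl)
first-step {S = TF} v with covering-head v 1F refl
... | horiz 1F     , sv , _ = _ , putH₁  , determined v putH₁  (sv ∷ [])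
... | corner 0F 0F , sv , _ = _ , putT₀₀ , determined v putT₀₀ (sv ∷ [])
... | horiz 0F     , _  , ()
... | corner 1F 0F , _  , ()
... | vert         , sv , _ = ⊥-elim (tiles-avoid-filled v {0F} refl sv refl)
... | corner 0F 1F , sv , _ = ⊥-elim (tiles-avoid-filled v {0F} refl sv refl)
... | corner 1F 1F , sv , _ = ⊥-elim (tiles-avoid-filled v {0F} refl sv refl)
first-step {S = TT} v = _ , pass , determined v pass []

decode : ∀ m S (s : Placement m → Bool) → Tiles m S s → Σ (Walk S (suc m)) λ w → enc w ≗ s
decode zero FF s v with v 0F zero
... | vdom zero , sv , _ = putV ∷ [] , λ { (vdom zero) → sym sv }
decode zero FT s v with v 0F zero
... | vdom zero , sv , _ = ⊥-elim (v 1F zero (vdom zero) sv refl)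
decode zero TF s v with v 1F zero
... | vdom zero , sv , _ = ⊥-elim (v 0F zero (vdom zero) sv refl)
decode zero TT s v with s (vdom zero) in sv
... | true  = ⊥-elim (v 0F zero (vdom zero) sv refl)
... | false = pass ∷ [] , λ { (vdom zero) → sym sv }
decode (suc m) S s v
  with S' , σ , s≗σ ← first-step v
  with w , enc≗ ← decode m S' (s ∘ shift) (tail-tiles v (Fits.leaves (fits-cong (sym ∘ s≗σ) (fits σ))))
  = σ ∷ w , λ p → trans (glue-cong (sym ∘ s≗σ) enc≗ p) (glue-split s p)

Family : ℕ → Set
Family m = Σ ℕ λ n → Fin n → Placement m

families : ∀ m → List (Family m)
families m = (suc m , vdom) ∷ (m , hdom 0F) ∷ (m , hdom 1F) ∷
             (m , trom 0F 0F) ∷ (m , trom 0F 1F) ∷ (m , trom 1F 0F) ∷ (m , trom 1F 1F) ∷ []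

members : ∀ {m} → Family m → List (Placement m)
members (n , f) = map f (allFin n)

allPlacements-families : ∀ m → allPlacements m ≡ concat (map members (families m))
allPlacements-families m =
  cong (members (suc m , vdom) ++_)
       (trans (cong (concat horizontals ++_) (concat-concat trominoes)) (concat-++ horizontals (concat trominoes)))
  where
  horizontals = members (m , hdom 0F) ∷ members (m , hdom 1F) ∷ []
  trominoes = (members (m , trom 0F 0F) ∷ members (m , trom 0F 1F) ∷ []) ∷
              (members (m , trom 1F 0F) ∷ members (m , trom 1F 1F) ∷ []) ∷ []

familyCount : ∀ {m} → (Placement m → Bool) → Family m → ℕ
familyCount q (n , f) = countFin n (q ∘ f)

count-allPlacements : ∀ m (q : Placement m → Bool) →
                      count q (allPlacements m) ≡ sum (map (familyCount q) (families m))
count-allPlacements m q = begin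
  count q (allPlacements m)                        ≡⟨ cong (count q) (allPlacements-families m) ⟩
  count q (concat (map members (families m)))      ≡⟨ count-concat q (map members (families m)) ⟩
  sum (map (count q) (map members (families m)))   ≡⟨ cong sum (map-∘ {g = count q} {members} (families m)) ⟨
  sum (map (count q ∘ members) (families m))
    ≡⟨ cong sum (map-cong (λ (n , f) → count-allFin q n f) (families m)) ⟩
  sum (map (familyCount q) (families m))           ∎
  where open ≡-Reasoning

count-allPlacements-suc : ∀ m (q : Placement (suc m) → Bool) →
  count q (allPlacements (suc m)) ≡ countHeads (q ∘ head) + count (q ∘ shift) (allPlacements m)
count-allPlacements-suc m q = begin
  count q (allPlacements (suc m))                ≡⟨ count-allPlacements (suc m) q ⟩
  sum (zipWith _+_ firsts rests)                 ≡⟨ sum-zipWith-+ firsts rests refl ⟩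
  countHeads (q ∘ head) + sum rests
    ≡⟨ cong (countHeads (q ∘ head) +_) (count-allPlacements m (q ∘ shift)) ⟨
  countHeads (q ∘ head) + count (q ∘ shift) (allPlacements m) ∎
  where
  open ≡-Reasoning
  firsts = map (bit ∘ q ∘ head) allHeads
  rests = map (familyCount (q ∘ shift)) (families m)

count-glue : ∀ {m} (H : Head → Bool) (s : Placement m → Bool) (K : Placement (suc m) → Bool) →
  count (λ p → glue H s p ∧ K p) (allPlacements (suc m)) ≡
  countHeads (λ h → H h ∧ K (head h)) + count (λ p → s p ∧ K (shift p)) (allPlacements m)
count-glue {m} H s K =
  trans (count-allPlacements-suc m (λ p → glue H s p ∧ K p))
        (cong₂ _+_ (count-cong (λ h → cong (_∧ K (head h)) (glue-head {m} H s h)) allHeads)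
                   (count-cong (λ p → cong (_∧ K (shift p)) (glue-shift H s p)) (allPlacements m)))

-- K must not depend on where a placement lies, nor on the width of the board.
module PieceCount (K : ∀ {m} → Placement m → Bool)
                  (K-head : ∀ {m} h → K (head {m} h) ≡ K (head {0} h))
                  (K-vdom : K (vdom {0} zero) ≡ K (head {0} vert))
                  (K-shift : ∀ {m} (p : Placement m) → K (shift p) ≡ K p) where

  pieces : ∀ {S n} → Walk S n → ℕ
  pieces []      = 0
  pieces (σ ∷ w) = countHeads (λ h → placed σ h ∧ K (head {0} h)) + pieces w

  count-enc : ∀ {S m} (w : Walk S (suc m)) → count (λ p → enc w p ∧ K p) (allPlacements m) ≡ pieces w
  count-enc {m = zero}  (putV ∷ []) = trans (cong (λ b → bit b + 0) K-vdom) (sym (+-identityʳ _))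
  count-enc {m = zero}  (pass ∷ []) = refl
  count-enc {m = suc m} (σ ∷ w)     =
    trans (count-glue (placed σ) (enc w) K)
          (cong₂ _+_ (count-cong (λ h → cong (placed σ h ∧_) (K-head {m} h)) allHeads)
                     (trans (count-cong (λ p → cong (enc w p ∧_) (K-shift p)) (allPlacements m)) (count-enc w)))

  countSel-enc : ∀ {m} (T : Tiling m) (w : Walk FF (suc m)) → sel T ≗ enc w → countSel T K ≡ pieces w
  countSel-enc {m} T w eq =
    trans (count-filter K (sel T) (allPlacements m))
          (trans (count-cong (λ p → cong (_∧ K p) (eq p)) (allPlacements m)) (count-enc w))

isDomino-head : ∀ {m} h → isDomino (head {m} h) ≡ isDomino (head {0} h)
isDomino-head vert         = refl
isDomino-head (horiz _)    = refl
isDomino-head (corner _ _) = refl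

isDomino-shift : ∀ {m} (p : Placement m) → isDomino (shift p) ≡ isDomino p
isDomino-shift (vdom _)     = refl
isDomino-shift (hdom _ _)   = refl
isDomino-shift (trom _ _ _) = refl

isTromino-head : ∀ {m} h → isTromino (head {m} h) ≡ isTromino (head {0} h)
isTromino-head vert         = refl
isTromino-head (horiz _)    = refl
isTromino-head (corner _ _) = refl

isTromino-shift : ∀ {m} (p : Placement m) → isTromino (shift p) ≡ isTromino p
isTromino-shift (vdom _)     = refl
isTromino-shift (hdom _ _)   = refl
isTromino-shift (trom _ _ _) = refl

open PieceCount isDomino isDomino-head refl isDomino-shift
  renaming (pieces to dominoes; countSel-enc to numDominoes-enc) using ()
open PieceCount isTromino isTromino-head refl isTromino-shift
  renaming (pieces to trominoes; countSel-enc to numTrominoes-enc) using ()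

-- Tilings as walks

Walks : Profile → ℕ → ℕ → ℕ → Set
Walks S n d e = Σ (Walk S n) λ w → (dominoes w ≡ d) × (trominoes w ≡ e)

Walks-≡ : ∀ {S n d e} {x y : Walks S n d e} → proj₁ x ≡ proj₁ y → x ≡ y
Walks-≡ {x = w , _} {.w , _} refl = cong (w ,_) (cong₂ _,_ (≡-irrelevant _ _) (≡-irrelevant _ _))

module _ {m d e : ℕ} where

  toTiling : Walks FF (suc m) d e → TilingWith m d e
  toTiling (w , dw , ew) =
    T , trans (numDominoes-enc T w (λ _ → refl)) dw , trans (numTrominoes-enc T w (λ _ → refl)) ew
    where T = tiles⇒tiling (enc-tiles w)

  toWalk : TilingWith m d e → Walks FF (suc m) d e
  toWalk (T , dT , eT) with w , enc≗ ← decode m FF (sel T) (tiling⇒tiles T) =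
    w , trans (sym (numDominoes-enc T w (sym ∘ enc≗))) dT , trans (sym (numTrominoes-enc T w (sym ∘ enc≗))) eT

  enc-toWalk : ∀ a → enc (proj₁ (toWalk a)) ≗ sel (proj₁ a)
  enc-toWalk (T , _) = proj₂ (decode m FF (sel T) (tiling⇒tiles T))

  toWalk-toTiling : ∀ x → toWalk (toTiling x) ≡ x
  toWalk-toTiling x = Walks-≡ (enc-injective _ _ (enc-toWalk (toTiling x)))

  toWalk-cong : ∀ a b → SameTiling a b → toWalk a ≡ toWalk b
  toWalk-cong a b a≈b =
    Walks-≡ (enc-injective _ _ λ p → trans (enc-toWalk a p) (trans (a≈b p) (sym (enc-toWalk b p))))

  hasCount-via-walks : ∀ {N} → Fin N ↔ Walks FF (suc m) d e → HasCount (TilingWith m d e) SameTiling N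
  hasCount-via-walks I =
    toTiling ∘ to , from ∘ toWalk ,
    (λ i → trans (cong from (toWalk-toTiling (to i))) (strictlyInverseʳ i)) ,
    (λ a p → trans (cong (λ x → enc (proj₁ x) p) (strictlyInverseˡ (toWalk a))) (enc-toWalk a p)) ,
    (λ a b a≈b → cong from (toWalk-cong a b a≈b))
    where open Inverse I

-- Counting walks

module _ {n e : ℕ} where

  dominoFree-split : Walks FF (3 + n) 0 (2 + e) → Walks FF n 0 e ⊎ Walks FF n 0 e
  dominoFree-split (putT₀₁ ∷ putT₁₀ ∷ pass ∷ w , d , t) = inj₁ (w , d , suc-injective (suc-injective t))
  dominoFree-split (putT₁₁ ∷ putT₀₀ ∷ pass ∷ w , d , t) = inj₂ (w , d , suc-injective (suc-injective t))
  dominoFree-split (putV ∷ _ , () , _)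
  dominoFree-split (putH² ∷ _ , () , _)
  dominoFree-split (putT₀₁ ∷ putH₀ ∷ _ , () , _)
  dominoFree-split (putT₁₁ ∷ putH₁ ∷ _ , () , _)

  dominoFree-join : Walks FF n 0 e ⊎ Walks FF n 0 e → Walks FF (3 + n) 0 (2 + e)
  dominoFree-join (inj₁ (w , d , t)) = putT₀₁ ∷ putT₁₀ ∷ pass ∷ w , d , cong (2 +_) t
  dominoFree-join (inj₂ (w , d , t)) = putT₁₁ ∷ putT₀₀ ∷ pass ∷ w , d , cong (2 +_) t

  dominoFree-join-split : ∀ x → dominoFree-join (dominoFree-split x) ≡ x
  dominoFree-join-split (putT₀₁ ∷ putT₁₀ ∷ pass ∷ w , d , t) = Walks-≡ refl
  dominoFree-join-split (putT₁₁ ∷ putT₀₀ ∷ pass ∷ w , d , t) = Walks-≡ refl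
  dominoFree-join-split (putV ∷ _ , () , _)
  dominoFree-join-split (putH² ∷ _ , () , _)
  dominoFree-join-split (putT₀₁ ∷ putH₀ ∷ _ , () , _)
  dominoFree-join-split (putT₁₁ ∷ putH₁ ∷ _ , () , _)

  dominoFree-split-join : ∀ y → dominoFree-split (dominoFree-join y) ≡ y
  dominoFree-split-join (inj₁ _) = cong inj₁ (Walks-≡ refl)
  dominoFree-split-join (inj₂ _) = cong inj₂ (Walks-≡ refl)

  dominoFree-↔ : Walks FF (3 + n) 0 (2 + e) ↔ (Walks FF n 0 e ⊎ Walks FF n 0 e)
  dominoFree-↔ = mk↔ₛ′ dominoFree-split dominoFree-join dominoFree-split-join dominoFree-join-split

  OneDominoParts : Set
  OneDominoParts = Walks FF (3 + n) 0 (2 + e) ⊎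
                   ((Walks FF n 0 e ⊎ Walks FF (1 + n) 1 e) ⊎ (Walks FF n 0 e ⊎ Walks FF (1 + n) 1 e))

  oneDomino-split : Walks FF (4 + n) 1 (2 + e) → OneDominoParts
  oneDomino-split (putV ∷ w , d , t) = inj₁ (w , suc-injective d , t)
  oneDomino-split (putT₀₁ ∷ putH₀ ∷ putT₀₀ ∷ pass ∷ w , d , t) =
    inj₂ (inj₁ (inj₁ (w , suc-injective d , suc-injective (suc-injective t))))
  oneDomino-split (putT₀₁ ∷ putT₁₀ ∷ pass ∷ w , d , t) =
    inj₂ (inj₁ (inj₂ (w , d , suc-injective (suc-injective t))))
  oneDomino-split (putT₁₁ ∷ putH₁ ∷ putT₁₀ ∷ pass ∷ w , d , t) =
    inj₂ (inj₂ (inj₁ (w , suc-injective d , suc-injective (suc-injective t))))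
  oneDomino-split (putT₁₁ ∷ putT₀₀ ∷ pass ∷ w , d , t) =
    inj₂ (inj₂ (inj₂ (w , d , suc-injective (suc-injective t))))
  oneDomino-split (putH² ∷ _ , () , _)
  oneDomino-split (putT₀₁ ∷ putH₀ ∷ putH₁ ∷ _ , () , _)
  oneDomino-split (putT₁₁ ∷ putH₁ ∷ putH₀ ∷ _ , () , _)

  oneDomino-join : OneDominoParts → Walks FF (4 + n) 1 (2 + e)
  oneDomino-join (inj₁ (w , d , t))               = putV ∷ w , cong suc d , t
  oneDomino-join (inj₂ (inj₁ (inj₁ (w , d , t)))) =
    putT₀₁ ∷ putH₀ ∷ putT₀₀ ∷ pass ∷ w , cong suc d , cong (2 +_) t
  oneDomino-join (inj₂ (inj₁ (inj₂ (w , d , t)))) = putT₀₁ ∷ putT₁₀ ∷ pass ∷ w , d , cong (2 +_) t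
  oneDomino-join (inj₂ (inj₂ (inj₁ (w , d , t)))) =
    putT₁₁ ∷ putH₁ ∷ putT₁₀ ∷ pass ∷ w , cong suc d , cong (2 +_) t
  oneDomino-join (inj₂ (inj₂ (inj₂ (w , d , t)))) = putT₁₁ ∷ putT₀₀ ∷ pass ∷ w , d , cong (2 +_) t

  oneDomino-join-split : ∀ x → oneDomino-join (oneDomino-split x) ≡ x
  oneDomino-join-split (putV ∷ w , d , t)                           = Walks-≡ refl
  oneDomino-join-split (putT₀₁ ∷ putH₀ ∷ putT₀₀ ∷ pass ∷ w , d , t) = Walks-≡ refl
  oneDomino-join-split (putT₀₁ ∷ putT₁₀ ∷ pass ∷ w , d , t)         = Walks-≡ refl
  oneDomino-join-split (putT₁₁ ∷ putH₁ ∷ putT₁₀ ∷ pass ∷ w , d , t) = Walks-≡ refl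
  oneDomino-join-split (putT₁₁ ∷ putT₀₀ ∷ pass ∷ w , d , t)         = Walks-≡ refl
  oneDomino-join-split (putH² ∷ _ , () , _)
  oneDomino-join-split (putT₀₁ ∷ putH₀ ∷ putH₁ ∷ _ , () , _)
  oneDomino-join-split (putT₁₁ ∷ putH₁ ∷ putH₀ ∷ _ , () , _)

  oneDomino-split-join : ∀ y → oneDomino-split (oneDomino-join y) ≡ y
  oneDomino-split-join (inj₁ _)               = cong inj₁ (Walks-≡ refl)
  oneDomino-split-join (inj₂ (inj₁ (inj₁ _))) = cong (inj₂ ∘ inj₁ ∘ inj₁) (Walks-≡ refl)
  oneDomino-split-join (inj₂ (inj₁ (inj₂ _))) = cong (inj₂ ∘ inj₁ ∘ inj₂) (Walks-≡ refl)
  oneDomino-split-join (inj₂ (inj₂ (inj₁ _))) = cong (inj₂ ∘ inj₂ ∘ inj₁) (Walks-≡ refl)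
  oneDomino-split-join (inj₂ (inj₂ (inj₂ _))) = cong (inj₂ ∘ inj₂ ∘ inj₂) (Walks-≡ refl)

  oneDomino-↔ : Walks FF (4 + n) 1 (2 + e) ↔ OneDominoParts
  oneDomino-↔ = mk↔ₛ′ oneDomino-split oneDomino-join oneDomino-split-join oneDomino-join-split

dominoFree : ∀ t → Fin (2 ^ t) ↔ Walks FF (3 * t) 0 (2 * t)

dominoFree-suc : ∀ t → Fin (2 ^ suc t) ↔ Walks FF (3 + 3 * t) 0 (2 + 2 * t)
dominoFree-suc t = begin
  Fin (2 ^ suc t)                                           ≡⟨ cong (Fin ∘ (2 ^ t +_)) (+-identityʳ (2 ^ t)) ⟩
  Fin (2 ^ t + 2 ^ t)                                       ↔⟨ +↔⊎ ⟩
  (Fin (2 ^ t) ⊎ Fin (2 ^ t))                               ↔⟨ dominoFree t ⊎-↔ dominoFree t ⟩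
  (Walks FF (3 * t) 0 (2 * t) ⊎ Walks FF (3 * t) 0 (2 * t)) ↔⟨ dominoFree-↔ ⟨
  Walks FF (3 + 3 * t) 0 (2 + 2 * t)                        ∎
  where open EquationalReasoning

dominoFree zero    = mk↔ₛ′ (λ _ → [] , refl , refl) (λ _ → zero)
                           (λ { ([] , refl , refl) → refl }) (λ { zero → refl })
dominoFree (suc t) = begin
  Fin (2 ^ suc t)                    ↔⟨ dominoFree-suc t ⟩
  Walks FF (3 + 3 * t) 0 (2 + 2 * t) ≡⟨ cong₂ (λ n e → Walks FF n 0 e) (*-suc 3 t) (*-suc 2 t) ⟨
  Walks FF (3 * suc t) 0 (2 * suc t) ∎
  where open EquationalReasoning

oneDomino-size : ∀ t y → (2 * suc t + 1) * (2 * y) ≡ 2 * y + ((y + (2 * t + 1) * y) + (y + (2 * t + 1) * y))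
oneDomino-size = solve-∀

oneDomino : ∀ t → Fin ((2 * t + 1) * 2 ^ t) ↔ Walks FF (suc (3 * t)) 1 (2 * t)
oneDomino zero    = mk↔ₛ′ (λ _ → putV ∷ [] , refl , refl) (λ _ → zero)
                          (λ { (putV ∷ [] , refl , refl) → refl }) (λ { zero → refl })
oneDomino (suc t) = begin
  Fin ((2 * suc t + 1) * 2 ^ suc t)                    ≡⟨ cong Fin (oneDomino-size t (2 ^ t)) ⟩
  Fin (2 ^ suc t + ((2 ^ t + N) + (2 ^ t + N)))         ↔⟨ +↔⊎ ⟩
  (Fin (2 ^ suc t) ⊎ Fin ((2 ^ t + N) + (2 ^ t + N)))
    ↔⟨ dominoFree-suc t ⊎-↔ ↔-trans +↔⊎ (rest ⊎-↔ rest) ⟩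
  OneDominoParts                                       ↔⟨ oneDomino-↔ ⟨
  Walks FF (4 + 3 * t) 1 (2 + 2 * t)
    ≡⟨ cong₂ (λ n e → Walks FF (suc n) 1 e) (*-suc 3 t) (*-suc 2 t) ⟨
  Walks FF (suc (3 * suc t)) 1 (2 * suc t)             ∎
  where
  open EquationalReasoning
  N = (2 * t + 1) * 2 ^ t
  rest : Fin (2 ^ t + N) ↔ (Walks FF (3 * t) 0 (2 * t) ⊎ Walks FF (1 + 3 * t) 1 (2 * t))
  rest = ↔-trans +↔⊎ (dominoFree t ⊎-↔ oneDomino t)

-- The count is also right for t = 0.
theorem5 : (t : ℕ) → 1 ≤ t →
    HasCount (TilingWith (3 * t) 1 (2 * t)) SameTiling ((2 * t + 1) * 2 ^ t)
theorem5 t _ = hasCount-via-walks (oneDomino t)
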